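{- Let $k$, $n$, $d$ be positive integers with $n\geq 2d$, $\gcd(n,d)=1$, and $\frac{n}{d}<k$. Let $G$ be a finite, simple, undirected, connected graph with chromatic number $\chi(G)=k$ and circular chromatic number $\chi_c(G)=\frac{n}{d}$. Then $G$ has a $k$-coloring $f$ such that (1) for at least $\left(\frac{\chi(G)(\chi_c(G)+1-\chi(G))}{\chi_c(G)}\right)|V(G)|$ vertices $u$ of $G$, some full $f$-rainbow path begins at $u$, and (2) for every remaining vertex $v$ of $G$, some $f$-rainbow path of order $k-1$ begins at $v$.
   Context: For a positive integer $k$, $[k]=\{1,\dots,k\}$. A $k$-coloring of $G$ is a function $f:V(G)\to[k]$ with $f(u)\neq f(v)$ for all adjacent $u,v$; $\chi(G)$ is the least $k$ for which a $k$-coloring exists. For positive integers $n,d$ with $n\ge 2d$ and $\gcd(n,d)=1$, an $(n,d)$-coloring of $G$ is a function $c:V(G)\to[n]$ with $d\le |c(u)-c(v)|\le n-d$ for all adjacent $u,v$; the circular chromatic number $\chi_c(G)$ is the infimum (in fact a minimum) of $n/d$ over all $(n,d)$-colorings of $G$. For a $k$-coloring $f$, an $f$-rainbow path is a path in $G$ whose vertices receive pairwise distinct colors under $f$; it is full if it has order $k$ (exactly $k$ vertices). A path begins at $u$ if $u$ is its first vertex (an end vertex). -}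

module Defs where

open import Data.Nat using (ℕ; zero; suc; _+_; _*_; _∸_; _≤_; _<_; ∣_-_∣)
open import Data.Nat.GCD using (gcd)
open import Data.Fin using (Fin; toℕ)
open import Data.List using (List; []; _∷_; length; map; _++_)
open import Data.List.Relation.Unary.Linked using (Linked)
open import Data.List.Relation.Unary.Unique.Propositional using (Unique)
open import Data.List.Membership.Propositional using (_∈_)
open import Data.Product using (Σ; ∃; _×_; _,_)
open import Relation.Nullary using (¬_; Dec)
open import Relation.Binary.PropositionalEquality using (_≡_)

record Graph : Set₁ where
  field
    N     : ℕ
    Adj   : Fin N → Fin N → Set
    sym   : ∀ {u v} → Adj u v → Adj v u
    irrefl : ∀ {u} → ¬ Adj u u
    dec   : ∀ u v → Dec (Adj u v)

open Graph public

IsPath : (G : Graph) → List (Fin (N G)) → Set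
IsPath G p = Linked (Adj G) p × Unique p

PathFrom : (G : Graph) → Fin (N G) → ℕ → List (Fin (N G)) → Set
PathFrom G u m p = IsPath G p × Σ (List (Fin (N G))) (λ rest → p ≡ u ∷ rest) × length p ≡ m

Connected : Graph → Set
Connected G = ∀ u v → ∃ λ p → IsPath G (u ∷ p) × Σ (List (Fin (N G))) (λ q → u ∷ p ≡ q ++ (v ∷ []))

IsColoring : (G : Graph) (k : ℕ) → (Fin (N G) → Fin k) → Set
IsColoring G k f = ∀ {u v} → Adj G u v → ¬ f u ≡ f v

Colorable : Graph → ℕ → Set
Colorable G k = ∃ λ f → IsColoring G k f

ChromaticNumber : Graph → ℕ → Set
ChromaticNumber G k = Colorable G k × (∀ j → j < k → ¬ Colorable G j)

-- (n,d)-coloring: colors [n] represented by Fin n (shift by one does not affect differences).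
IsNDColoring : (G : Graph) (n d : ℕ) → (Fin (N G) → Fin n) → Set
IsNDColoring G n d c = ∀ {u v} → Adj G u v →
  d ≤ ∣ toℕ (c u) - toℕ (c v) ∣ × ∣ toℕ (c u) - toℕ (c v) ∣ ≤ n ∸ d

ValidND : ℕ → ℕ → Set
ValidND n d = 1 ≤ d × 2 * d ≤ n × gcd n d ≡ 1

NDColorable : Graph → ℕ → ℕ → Set
NDColorable G n d = ∃ λ c → IsNDColoring G n d c

-- χ_c(G) = n/d : minimum of n'/d' over (n',d')-colorings, attained at (n,d).
-- n/d ≤ n'/d'  is expressed as  n * d' ≤ n' * d.
CircularChromaticNumber : Graph → ℕ → ℕ → Set
CircularChromaticNumber G n d =
  NDColorable G n d ×
  (∀ n' d' → ValidND n' d' → NDColorable G n' d' → n * d' ≤ n' * d)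

RainbowPathFrom : (G : Graph) (k : ℕ) (f : Fin (N G) → Fin k) → Fin (N G) → ℕ → Set
RainbowPathFrom G k f u m = ∃ λ p → PathFrom G u m p × Unique (map f p)

FullRainbowFrom : (G : Graph) (k : ℕ) (f : Fin (N G) → Fin k) → Fin (N G) → Set
FullRainbowFrom G k f u = RainbowPathFrom G k f u k

module Submission where

-- Fix an (n,d)-colouring c and call an edge uv tight when c v ≡ c u + d (mod n). If the tight
-- edges carried no directed cycle, refining c by the length of the longest tight walk ending at
-- each vertex would give an (M n, M d + 1)-colouring, contradicting χ_c = n/d; so a tight cycle
-- exists. Lifting c to natural-number labels and repeatedly lowering by one every label without a
-- tight in-neighbour (the cycle never moves, which bounds the process) gives labels L in which
-- every vertex has a tight in-neighbour. Write k = K + 1 and n = K d + t with t < d. For a shift s,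
-- colour v by ⌊((L v + s) mod n) / d⌋: walking back along tight in-neighbours lowers the residue
-- by d per step, so the colours count down and wrap around at most once. The k-vertex walk
-- from v is rainbow unless its wrap-around skips the top colour class, which for each v is
-- avoided by exactly (K + 1) t of the n shifts; otherwise it still shows K distinct colours.
-- Averaging over s gives a shift with the required number of full starts.

open import Defs hiding (sym)
open import Data.Fin as Fin using (Fin; toℕ; fromℕ<)
open import Data.Fin.Properties using (toℕ-fromℕ<; toℕ<n; any?; all?; ¬∀⟶∃¬; pigeonhole)
open import Data.List as List using (List; []; _∷_; _++_; length; map; filter; allFin)
open import Data.List.Membership.Propositional using (_∈_)
open import Data.List.Membership.Propositional.Properties using (∈-allFin; ∈-map⁺; ∈-filter⁻)
open import Data.List.Properties using (∷-injective; map-++; map-∘; map-cong; length-iterate; length-tabulate)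
open import Data.List.Relation.Unary.All as All using (All; []; _∷_)
open import Data.List.Relation.Unary.AllPairs using ([]; _∷_)
open import Data.List.Relation.Unary.Any using (here; there)
open import Data.List.Relation.Unary.Linked using (Linked; []; [-]; _∷_)
open import Data.List.Relation.Unary.Unique.Propositional using (Unique)
import Data.List.Relation.Unary.Unique.Propositional.Properties as Unique
open import Data.Nat using (ℕ; zero; suc; pred; _+_; _*_; _∸_; _≤_; _<_; z≤n; s≤s; z<s; NonZero; >-nonZero; >-nonZero⁻¹; ∣_-_∣)
open import Data.Nat.Coprimality using (Coprime; coprime-divisor; coprime⇒gcd≡1)
open import Data.Nat.Divisibility using (_∣_; n∣m*n; m∣m*n; ∣m⇒∣m*n; ∣m+n∣m⇒∣n; ∣1⇒≡1; ∣-trans)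
open import Data.Nat.DivMod
open import Data.Nat.GCD using (gcd)
import Data.Nat.GeneralisedArithmetic as ℕ
open import Data.Nat.ListAction using (sum)
open import Data.Nat.Properties
open import Algebra.Properties.CommutativeSemigroup +-commutativeSemigroup using (xy∙z≈xz∙y; x∙yz≈y∙xz)
open import Data.Nat.Tactic.RingSolver using (solve-∀)
open import Data.Product using (Σ; ∃; ∃₂; _×_; _,_; proj₁; proj₂)
open import Data.Sum as Sum using (_⊎_; inj₁; inj₂; [_,_]′)
open import Function using (_∘_; id)
open import Relation.Binary.PropositionalEquality
open import Relation.Nullary using (Dec; yes; no; ¬_; contradiction)
open import Relation.Nullary.Decidable using (_×-dec_; _⊎-dec_)
open import Relation.Unary using (Pred; Decidable)

m≤n∧o≤n∸m⇒m+o≤n : ∀ {m n o} → m ≤ n → o ≤ n ∸ m → m + o ≤ n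
m≤n∧o≤n∸m⇒m+o≤n {m} {n} {o} m≤n o≤n∸m = subst (_≤ n) (+-comm o m) (m≤o∸n⇒m+n≤o o m≤n o≤n∸m)

-- Circular (n,d)-separation read on representatives: b is at least d after a and at least d
-- before a + n.
Separated : ℕ → ℕ → ℕ → ℕ → Set
Separated n d a b = a + d ≤ b × b + d ≤ a + n

-- b ≡ a + d (mod n), for representatives differing by less than n.
Tight : ℕ → ℕ → ℕ → ℕ → Set
Tight n d a b = a + d ≡ b ⊎ a + d ≡ b + n

module _ {n d : ℕ} where

  separated⇒offset : ∀ {a b} → Separated n d a b → a ≤ b × d ≤ b ∸ a × b ∸ a + d ≤ n
  separated⇒offset {a} {b} (a+d≤b , b+d≤a+n) =
    a≤b ,
    m+n≤o⇒m≤o∸n d (subst (_≤ b) (+-comm a d) a+d≤b) ,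
    (begin
      b ∸ a + d   ≡⟨ +-∸-comm d a≤b ⟨
      b + d ∸ a   ≤⟨ ∸-monoˡ-≤ a b+d≤a+n ⟩
      a + n ∸ a   ≡⟨ m+n∸m≡n a n ⟩
      n           ∎)
    where
    open ≤-Reasoning
    a≤b : a ≤ b
    a≤b = m+n≤o⇒m≤o a a+d≤b

  offset⇒separated : ∀ {a b} → a ≤ b → d ≤ b ∸ a → b ∸ a + d ≤ n → Separated n d a b
  offset⇒separated {a} {b} a≤b lower upper =
    m≤n∧o≤n∸m⇒m+o≤n a≤b lower ,
    (begin
      b + d               ≡⟨ cong (_+ d) (m+[n∸m]≡n a≤b) ⟨
      a + (b ∸ a) + d     ≡⟨ +-assoc a (b ∸ a) d ⟩
      a + (b ∸ a + d)     ≤⟨ +-monoʳ-≤ a upper ⟩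
      a + n               ∎)
    where open ≤-Reasoning

  separated⇒distance : ∀ {a b} → Separated n d a b → d ≤ ∣ a - b ∣ × ∣ a - b ∣ ≤ n ∸ d
  separated⇒distance s with separated⇒offset s
  ... | a≤b , lower , upper rewrite m≤n⇒∣m-n∣≡n∸m a≤b = lower , m+n≤o⇒m≤o∸n _ upper

  separated-either⇒distance : ∀ {a b} → Separated n d a b ⊎ Separated n d b a →
                              d ≤ ∣ a - b ∣ × ∣ a - b ∣ ≤ n ∸ d
  separated-either⇒distance         (inj₁ s) = separated⇒distance s
  separated-either⇒distance {a} {b} (inj₂ s) =
    subst (λ x → d ≤ x × x ≤ n ∸ d) (∣-∣-comm b a) (separated⇒distance s)

  distance⇒separated : ∀ {a b} → d ≤ n → d ≤ ∣ a - b ∣ → ∣ a - b ∣ ≤ n ∸ d →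
                       Separated n d a b ⊎ Separated n d b a
  distance⇒separated {a} {b} d≤n lower upper with ≤-total a b
  ... | inj₁ a≤b rewrite m≤n⇒∣m-n∣≡n∸m a≤b = inj₁ (offset⇒separated a≤b lower (m≤o∸n⇒m+n≤o _ d≤n upper))
  ... | inj₂ b≤a rewrite m≤n⇒∣n-m∣≡n∸m b≤a = inj₂ (offset⇒separated b≤a lower (m≤o∸n⇒m+n≤o _ d≤n upper))

  separated-+ : ∀ {a b} s → Separated n d a b → Separated n d (a + s) (b + s)
  separated-+ {a} {b} s (a+d≤b , b+d≤a+n) =
    subst (_≤ b + s) (xy∙z≈xz∙y a d s) (+-monoˡ-≤ s a+d≤b) ,
    subst₂ _≤_ (xy∙z≈xz∙y b d s) (xy∙z≈xz∙y a n s) (+-monoˡ-≤ s b+d≤a+n)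

  tight-+ : ∀ {a b} s → Tight n d a b → Tight n d (a + s) (b + s)
  tight-+ {a} {b} s (inj₁ a+d≡b) = inj₁ (trans (xy∙z≈xz∙y a s d) (cong (_+ s) a+d≡b))
  tight-+ {a} {b} s (inj₂ a+d≡b+n) =
    inj₂ (trans (xy∙z≈xz∙y a s d) (trans (cong (_+ s) a+d≡b+n) (xy∙z≈xz∙y b n s)))

module _ {n : ℕ} .{{_ : NonZero n}} where

  %-wrap : ∀ m → m < n + n → m % n ≡ m ⊎ m % n + n ≡ m
  %-wrap m m<2n with m <? n
  ... | yes m<n = inj₁ (m<n⇒m%n≡m m<n)
  ... | no m≮n = inj₂ (begin
    m % n + n         ≡⟨ cong (_+ n) (m≤n⇒[n∸m]%m≡n%m n≤m) ⟨
    (m ∸ n) % n + n   ≡⟨ cong (_+ n) (m<n⇒m%n≡m m∸n<n) ⟩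
    m ∸ n + n         ≡⟨ m∸n+n≡m n≤m ⟩
    m                 ∎)
    where
    open ≡-Reasoning
    n≤m : n ≤ m
    n≤m = ≮⇒≥ m≮n
    m∸n<n : m ∸ n < n
    m∸n<n = +-cancelʳ-< n (m ∸ n) n (subst (_< n + n) (sym (m∸n+n≡m n≤m)) m<2n)

  [m+n]%o≡[m%o+n]%o : ∀ a b → (a + b) % n ≡ (a % n + b) % n
  [m+n]%o≡[m%o+n]%o a b = begin
    (a + b) % n               ≡⟨ %-distribˡ-+ a b n ⟩
    (a % n + b % n) % n       ≡⟨ cong (λ x → (x + b % n) % n) (m%n%n≡m%n a n) ⟨
    (a % n % n + b % n) % n   ≡⟨ %-distribˡ-+ (a % n) b n ⟨
    (a % n + b) % n           ∎
    where open ≡-Reasoning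

module _ {n d : ℕ} .{{_ : NonZero n}} where

  separated-%-offset : ∀ a e → d ≤ e → e + d ≤ n →
    Separated n d (a % n) ((a + e) % n) ⊎ Separated n d ((a + e) % n) (a % n)
  separated-%-offset a e lower upper rewrite [m+n]%o≡[m%o+n]%o a e
    with %-wrap (a % n + e) (+-mono-<-≤ (m%n<n a n) (m+n≤o⇒m≤o e upper))
  ... | inj₁ z≡x+e rewrite z≡x+e =
    inj₁ (+-monoʳ-≤ (a % n) lower , ≤-trans (≤-reflexive (+-assoc (a % n) e d)) (+-monoʳ-≤ (a % n) upper))
  ... | inj₂ z+n≡x+e =
    inj₂ (+-cancelʳ-≤ n _ _ z+d+n≤x+n , subst (a % n + d ≤_) (sym z+n≡x+e) (+-monoʳ-≤ (a % n) lower))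
    where
    x z : ℕ
    x = a % n
    z = (x + e) % n
    z+d+n≤x+n : z + d + n ≤ x + n
    z+d+n≤x+n = begin
      z + d + n     ≡⟨ xy∙z≈xz∙y z d n ⟩
      z + n + d     ≡⟨ cong (_+ d) z+n≡x+e ⟩
      x + e + d     ≡⟨ +-assoc x e d ⟩
      x + (e + d)   ≤⟨ +-monoʳ-≤ x upper ⟩
      x + n         ∎
      where open ≤-Reasoning

  separated-% : ∀ {a b} → Separated n d a b →
                Separated n d (a % n) (b % n) ⊎ Separated n d (b % n) (a % n)
  separated-% {a} {b} s with separated⇒offset s
  ... | a≤b , lower , upper =
    subst (λ b → Separated n d (a % n) (b % n) ⊎ Separated n d (b % n) (a % n))
          (m+[n∸m]≡n a≤b) (separated-%-offset a (b ∸ a) lower upper)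

  tight⇒%≡ : ∀ {a b} → Tight n d a b → (a % n + d) % n ≡ b % n
  tight⇒%≡ {a} {b} t = trans (sym ([m+n]%o≡[m%o+n]%o a d)) (reduce t)
    where
    reduce : Tight n d a b → (a + d) % n ≡ b % n
    reduce (inj₁ a+d≡b) = cong (_% n) a+d≡b
    reduce (inj₂ a+d≡b+n) = trans (cong (_% n) a+d≡b+n) ([m+n]%n≡m%n b n)

  tight-% : ∀ {a b} → d < n → Tight n d a b → Tight n d (a % n) (b % n)
  tight-% {a} {b} d<n t with %-wrap (a % n + d) (+-mono-< (m%n<n a n) d<n)
  ... | inj₁ z≡x+d = inj₁ (trans (sym z≡x+d) (tight⇒%≡ t))
  ... | inj₂ z+n≡x+d = inj₂ (trans (sym z+n≡x+d) (cong (_+ n) (tight⇒%≡ t)))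

+-≤⇒/-< : ∀ {d a b} .{{_ : NonZero d}} → a + d ≤ b → a / d < b / d
+-≤⇒/-< {d} {a} {b} a+d≤b = begin-strict
  a / d                 <⟨ n<1+n (a / d) ⟩
  suc (a / d)           ≡⟨ cong (λ x → suc (x / d)) (m+n∸n≡m a d) ⟨
  suc ((a + d ∸ d) / d) ≡⟨ m/n≡1+[m∸n]/n (m≤n+m d a) ⟨
  (a + d) / d           ≤⟨ /-monoˡ-≤ d a+d≤b ⟩
  b / d                 ∎
  where open ≤-Reasoning

distance⇒/-≢ : ∀ {d a b} .{{_ : NonZero d}} → d ≤ ∣ a - b ∣ → a / d ≢ b / d
distance⇒/-≢ {d} {a} {b} d≤∣a-b∣ with ≤-total a b
... | inj₁ a≤b = <⇒≢ (+-≤⇒/-< (m≤n∧o≤n∸m⇒m+o≤n a≤b (subst (d ≤_) (m≤n⇒∣m-n∣≡n∸m a≤b) d≤∣a-b∣)))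
... | inj₂ b≤a =
  ≢-sym (<⇒≢ (+-≤⇒/-< (m≤n∧o≤n∸m⇒m+o≤n b≤a (subst (d ≤_) (m≤n⇒∣n-m∣≡n∸m b≤a) d≤∣a-b∣))))

*-+-lex-< : ∀ {M p q hp hq} → hp < M → p ≤ q → (p ≡ q → hp < hq) → M * p + hp < M * q + hq
*-+-lex-< {M} {p} {q} {hp} {hq} hp<M p≤q tie with m≤n⇒m<n∨m≡n p≤q
... | inj₂ refl = +-monoʳ-< (M * p) (tie refl)
... | inj₁ p<q = begin-strict
  M * p + hp    <⟨ +-monoʳ-< (M * p) hp<M ⟩
  M * p + M     ≡⟨ +-comm (M * p) M ⟩
  M + M * p     ≡⟨ *-suc M p ⟨
  M * suc p     ≤⟨ *-monoʳ-≤ M p<q ⟩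
  M * q         ≤⟨ m≤m+n (M * q) hq ⟩
  M * q + hq    ∎
  where open ≤-Reasoning

*-+-separated : ∀ {n d M a b ha hb} → ha < M → hb < M → Separated n d a b →
  (a + d ≡ b → ha < hb) → (b + d ≡ a + n → hb < ha) →
  Separated (M * n) (M * d + 1) (M * a + ha) (M * b + hb)
*-+-separated {n} {d} {M} {a} {b} {ha} {hb} ha<M hb<M (a+d≤b , b+d≤a+n) tie₁ tie₂ =
  subst (_≤ M * b + hb) (sym (shift M a ha d)) (*-+-lex-< ha<M a+d≤b tie₁) ,
  subst₂ _≤_ (sym (shift M b hb d)) (shift′ M a ha n) (*-+-lex-< hb<M b+d≤a+n tie₂)
  where
  shift : ∀ M x h e → M * x + h + (M * e + 1) ≡ suc (M * (x + e) + h)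
  shift = solve-∀
  shift′ : ∀ M x h e → M * (x + e) + h ≡ M * x + h + M * e
  shift′ = solve-∀

pred-separated : ∀ {n d a b} → 0 < a → ¬ Tight n d b a →
  Separated n d a b ⊎ Separated n d b a → Separated n d (pred a) b ⊎ Separated n d b (pred a)
pred-separated {a = suc a} _ ¬tight (inj₁ (a+d≤b , b+d≤a+n)) =
  inj₁ (≤-trans (n≤1+n (a + _)) a+d≤b , ≤-pred (≤∧≢⇒< b+d≤a+n (¬tight ∘ inj₂)))
pred-separated {a = suc a} _ ¬tight (inj₂ (b+d≤a , a+d≤b+n)) =
  inj₂ (≤-pred (≤∧≢⇒< b+d≤a (¬tight ∘ inj₁)) , ≤-trans (n≤1+n (a + _)) a+d≤b+n)

[m*n+o]/n≡m : ∀ m {n o} .{{_ : NonZero n}} → o < n → (m * n + o) / n ≡ m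
[m*n+o]/n≡m m {n} {o} o<n = begin
  (m * n + o) / n       ≡⟨ +-distrib-/-∣ˡ o (n∣m*n m) ⟩
  m * n / n + o / n     ≡⟨ cong₂ _+_ (m*n/n≡m m n) (m<n⇒m/n≡0 o<n) ⟩
  m + 0                 ≡⟨ +-identityʳ m ⟩
  m                     ∎
  where open ≡-Reasoning

m≡m/n*n+m%n : ∀ m n .{{_ : NonZero n}} → m ≡ m / n * n + m % n
m≡m/n*n+m%n m n = trans (m≡m%n+[m/n]*n m n) (+-comm (m % n) (m / n * n))

∑< : ℕ → (ℕ → ℕ) → ℕ
∑< zero    g = 0
∑< (suc m) g = ∑< m g + g m

syntax ∑< m (λ i → e) = ∑[ i < m ] e

∑-cong : ∀ m {g h : ℕ → ℕ} → (∀ i → i < m → g i ≡ h i) → ∑[ i < m ] g i ≡ ∑[ i < m ] h i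
∑-cong zero    eq = refl
∑-cong (suc m) eq = cong₂ _+_ (∑-cong m (λ i i<m → eq i (m<n⇒m<1+n i<m))) (eq m ≤-refl)

∑-const : ∀ m c → ∑[ i < m ] c ≡ m * c
∑-const zero    c = refl
∑-const (suc m) c = trans (cong (_+ c) (∑-const m c)) (+-comm (m * c) c)

∑-distrib-+ : ∀ m (g h : ℕ → ℕ) → ∑[ i < m ] (g i + h i) ≡ ∑[ i < m ] g i + ∑[ i < m ] h i
∑-distrib-+ zero    g h = refl
∑-distrib-+ (suc m) g h = trans (cong (_+ (g m + h m)) (∑-distrib-+ m g h))
                                (interchange (∑< m g) (∑< m h) (g m) (h m))
  where
  interchange : ∀ a b c e → a + b + (c + e) ≡ a + c + (b + e)
  interchange = solve-∀

∑-split : ∀ a b (g : ℕ → ℕ) → ∑[ i < a + b ] g i ≡ ∑[ i < a ] g i + ∑[ i < b ] g (a + i)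
∑-split a zero    g = trans (cong (λ m → ∑< m g) (+-identityʳ a)) (sym (+-identityʳ _))
∑-split a (suc b) g = begin
  ∑[ i < a + suc b ] g i                                ≡⟨ cong (λ m → ∑< m g) (+-suc a b) ⟩
  ∑[ i < a + b ] g i + g (a + b)                        ≡⟨ cong (_+ g (a + b)) (∑-split a b g) ⟩
  ∑[ i < a ] g i + ∑[ i < b ] g (a + i) + g (a + b)     ≡⟨ +-assoc (∑< a g) _ _ ⟩
  ∑[ i < a ] g i + ∑[ i < suc b ] g (a + i)             ∎
  where open ≡-Reasoning

∑-rotate₁ : ∀ m (g : ℕ → ℕ) → g m ≡ g 0 → ∑[ i < m ] g (suc i) ≡ ∑[ i < m ] g i
∑-rotate₁ m g gm≡g0 = +-cancelˡ-≡ (g 0) _ _ (begin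
  g 0 + ∑[ i < m ] g (suc i)    ≡⟨ ∑-split 1 m g ⟨
  ∑[ i < suc m ] g i            ≡⟨ cong (∑< m g +_) gm≡g0 ⟩
  ∑[ i < m ] g i + g 0          ≡⟨ +-comm (∑< m g) (g 0) ⟩
  g 0 + ∑[ i < m ] g i          ∎)
  where open ≡-Reasoning

∑-rotate : ∀ n .{{_ : NonZero n}} a (g : ℕ → ℕ) → ∑[ s < n ] g ((a + s) % n) ≡ ∑[ s < n ] g s
∑-rotate n zero    g = ∑-cong n (λ s s<n → cong g (m<n⇒m%n≡m s<n))
∑-rotate n (suc a) g = begin
  ∑[ s < n ] g ((suc a + s) % n)    ≡⟨ ∑-cong n (λ s _ → cong (λ x → g (x % n)) (+-suc a s)) ⟨
  ∑[ s < n ] g ((a + suc s) % n)    ≡⟨ ∑-rotate₁ n (λ s → g ((a + s) % n)) periodic ⟩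
  ∑[ s < n ] g ((a + s) % n)        ≡⟨ ∑-rotate n a g ⟩
  ∑[ s < n ] g s                    ∎
  where
  open ≡-Reasoning
  periodic : g ((a + n) % n) ≡ g ((a + 0) % n)
  periodic = cong g (trans ([m+n]%n≡m%n a n) (cong (_% n) (sym (+-identityʳ a))))

∃-term-≥-average : ∀ m (g : ℕ → ℕ) → 0 < m → ∃ λ s → s < m × ∑[ i < m ] g i ≤ m * g s
∃-term-≥-average (suc zero)    g _ = 0 , s≤s z≤n , ≤-reflexive (sym (+-identityʳ (g 0)))
∃-term-≥-average (suc (suc m)) g _ with ∃-term-≥-average (suc m) g (s≤s z≤n)
... | s , s<m , ∑≤ with g s ≤? g (suc m)
...   | yes gs≤gm = suc m , ≤-refl , (begin
        ∑[ i < suc m ] g i + g (suc m)    ≤⟨ +-monoˡ-≤ (g (suc m)) ∑≤ ⟩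
        suc m * g s + g (suc m)          ≤⟨ +-monoˡ-≤ (g (suc m)) (*-monoʳ-≤ (suc m) gs≤gm) ⟩
        suc m * g (suc m) + g (suc m)    ≡⟨ +-comm (suc m * g (suc m)) _ ⟩
        suc (suc m) * g (suc m)          ∎)
  where open ≤-Reasoning
...   | no gs≰gm = s , m<n⇒m<1+n s<m , (begin
        ∑[ i < suc m ] g i + g (suc m)    ≤⟨ +-mono-≤ ∑≤ (<⇒≤ (≰⇒> gs≰gm)) ⟩
        suc m * g s + g s                ≡⟨ +-comm (suc m * g s) _ ⟩
        suc (suc m) * g s                ∎)
  where open ≤-Reasoning

indicator : ∀ {p} {P : Set p} → Dec P → ℕ
indicator (yes _) = 1
indicator (no _)  = 0

indicator-yes : ∀ {p} {P : Set p} (P? : Dec P) → P → indicator P? ≡ 1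
indicator-yes (yes _) _ = refl
indicator-yes (no ¬p) p = contradiction p ¬p

indicator-no : ∀ {p} {P : Set p} (P? : Dec P) → ¬ P → indicator P? ≡ 0
indicator-no (yes p) ¬p = contradiction p ¬p
indicator-no (no _)  _  = refl

module _ {a p} {A : Set a} {P : ℕ → Pred A p} (P? : ∀ s → Decidable (P s)) where

  length-filter-∷ : ∀ s x xs → length (filter (P? s) (x ∷ xs)) ≡ indicator (P? s x) + length (filter (P? s) xs)
  length-filter-∷ s x xs with P? s x
  ... | yes _ = refl
  ... | no _  = refl

  ∑-length-filter : ∀ m c (xs : List A) → (∀ x → ∑[ s < m ] indicator (P? s x) ≡ c) →
                    ∑[ s < m ] length (filter (P? s) xs) ≡ length xs * c
  ∑-length-filter m c []       count = trans (∑-const m 0) (*-zeroʳ m)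
  ∑-length-filter m c (x ∷ xs) count = begin
    ∑[ s < m ] length (filter (P? s) (x ∷ xs))
      ≡⟨ ∑-cong m (λ s _ → length-filter-∷ s x xs) ⟩
    ∑[ s < m ] (indicator (P? s x) + length (filter (P? s) xs))
      ≡⟨ ∑-distrib-+ m _ _ ⟩
    ∑[ s < m ] indicator (P? s x) + ∑[ s < m ] length (filter (P? s) xs)
      ≡⟨ cong₂ _+_ (count x) (∑-length-filter m c xs count) ⟩
    c + length xs * c
      ∎
    where open ≡-Reasoning

countdown : ℕ → ℕ → List ℕ
countdown a zero    = []
countdown a (suc m) = a ∷ countdown (pred a) m

countdown-≤ : ∀ a m → All (_≤ a) (countdown a m)
countdown-≤ a zero    = []
countdown-≤ a (suc m) = ≤-refl ∷ All.map (λ x≤a-1 → ≤-trans x≤a-1 pred[n]≤n) (countdown-≤ (pred a) m)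

countdown-> : ∀ {b} a m → b + m ≤ a → All (b <_) (countdown a m)
countdown-> a       zero    _ = []
countdown-> {b} (suc a) (suc m) b+m<a =
  ≤-trans (s≤s (m≤m+n b m)) (subst (_≤ suc a) (+-suc b m) b+m<a) ∷
  countdown-> a m (≤-pred (subst (_≤ suc a) (+-suc b m) b+m<a))
countdown-> {b} zero (suc m) b+m<0 with () ← subst (_≤ 0) (+-suc b m) b+m<0

countdown-unique : ∀ a m → m ≤ suc a → Unique (countdown a m)
countdown-unique a       zero          _         = []
countdown-unique a       (suc zero)    _         = [] ∷ []
countdown-unique (suc a) (suc (suc m)) (s≤s m≤a) =
  All.map (λ x≤a a+1≡x → <-irrefl (sym a+1≡x) (s≤s x≤a)) (countdown-≤ a (suc m)) ∷
  countdown-unique a (suc m) m≤a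

countdown-++-unique : ∀ {j} a → j ≤ a → Unique (countdown j (suc j) ++ countdown a (a ∸ j))
countdown-++-unique {j} a j≤a =
  Unique.++⁺ (countdown-unique j (suc j) ≤-refl) (countdown-unique a (a ∸ j) (m≤n⇒m≤1+n (m∸n≤m a j)))
    λ (x∈low , x∈high) → <⇒≱ (All.lookup (countdown-> a (a ∸ j) (≤-reflexive (m+[n∸m]≡n j≤a))) x∈high)
                              (All.lookup (countdown-≤ j (suc j)) x∈low)

module Residues {d : ℕ} .{{_ : NonZero d}} (K t : ℕ) (t<d : t < d) where

  -- The residues x < K d + t from which a full rainbow path starts: either no wrap-around occurs
  -- along the next K + 1 steps, or the wrap-around lands high enough.
  FullResidue : ℕ → Set
  FullResidue x = K * d ≤ x ⊎ d ∸ t ≤ x % d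

  fullResidue? : Decidable FullResidue
  fullResidue? x = (K * d ≤? x) ⊎-dec (d ∸ t ≤? x % d)

  private
    [i+m*d]%d≡i : ∀ m {i} → i < d → (m * d + i) % d ≡ i
    [i+m*d]%d≡i m {i} i<d = trans (cong (_% d) (+-comm (m * d) i)) (trans ([m+kn]%n≡m%n i m d) (m<n⇒m%n≡m i<d))

    block : ∀ m → m < K → ∑[ i < d ] indicator (fullResidue? (m * d + i)) ≡ t
    block m m<K = begin
      ∑[ i < d ] indicator (fullResidue? (m * d + i))
        ≡⟨ cong (λ l → ∑< l (λ i → indicator (fullResidue? (m * d + i)))) (m∸n+n≡m (<⇒≤ t<d)) ⟨
      ∑[ i < d ∸ t + t ] indicator (fullResidue? (m * d + i))
        ≡⟨ ∑-split (d ∸ t) t _ ⟩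
      ∑[ i < d ∸ t ] indicator (fullResidue? (m * d + i)) + ∑[ i < t ] indicator (fullResidue? (m * d + (d ∸ t + i)))
        ≡⟨ cong₂ _+_ (trans (∑-cong (d ∸ t) low) (∑-const (d ∸ t) 0)) (trans (∑-cong t high) (∑-const t 1)) ⟩
      (d ∸ t) * 0 + t * 1
        ≡⟨ cong₂ _+_ (*-zeroʳ (d ∸ t)) (*-identityʳ t) ⟩
      t ∎
      where
      open ≡-Reasoning
      below-Kd : ∀ {i} → i < d → ¬ K * d ≤ m * d + i
      below-Kd {i} i<d Kd≤ = <⇒≱ (<-≤-trans (+-monoʳ-< (m * d) i<d)
                                   (subst (_≤ K * d) (+-comm d (m * d)) (*-monoˡ-≤ d m<K))) Kd≤
      low : ∀ i → i < d ∸ t → indicator (fullResidue? (m * d + i)) ≡ 0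
      low i i<d-t = indicator-no (fullResidue? (m * d + i))
        λ { (inj₁ Kd≤) → below-Kd i<d Kd≤
          ; (inj₂ d-t≤) → <⇒≱ i<d-t (subst (d ∸ t ≤_) ([i+m*d]%d≡i m i<d) d-t≤) }
        where
        i<d : i < d
        i<d = <-≤-trans i<d-t (m∸n≤m d t)
      high : ∀ i → i < t → indicator (fullResidue? (m * d + (d ∸ t + i))) ≡ 1
      high i i<t = indicator-yes (fullResidue? (m * d + (d ∸ t + i)))
        (inj₂ (subst (d ∸ t ≤_) (sym ([i+m*d]%d≡i m d-t+i<d)) (m≤m+n (d ∸ t) i)))
        where
        d-t+i<d : d ∸ t + i < d
        d-t+i<d = subst (d ∸ t + i <_) (m∸n+n≡m (<⇒≤ t<d)) (+-monoʳ-< (d ∸ t) i<t)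

    blocks : ∀ m → m ≤ K → ∑[ i < m * d ] indicator (fullResidue? i) ≡ m * t
    blocks zero    _   = refl
    blocks (suc m) m<K = begin
      ∑[ i < suc m * d ] indicator (fullResidue? i)
        ≡⟨ cong (λ l → ∑< l (λ i → indicator (fullResidue? i))) (+-comm d (m * d)) ⟩
      ∑[ i < m * d + d ] indicator (fullResidue? i)
        ≡⟨ ∑-split (m * d) d _ ⟩
      ∑[ i < m * d ] indicator (fullResidue? i) + ∑[ i < d ] indicator (fullResidue? (m * d + i))
        ≡⟨ cong₂ _+_ (blocks m (<⇒≤ m<K)) (block m m<K) ⟩
      m * t + t
        ≡⟨ +-comm (m * t) t ⟩
      suc m * t ∎
      where open ≡-Reasoning

  ∑-fullResidue : ∑[ x < K * d + t ] indicator (fullResidue? x) ≡ suc K * t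
  ∑-fullResidue = begin
    ∑[ x < K * d + t ] indicator (fullResidue? x)
      ≡⟨ ∑-split (K * d) t _ ⟩
    ∑[ x < K * d ] indicator (fullResidue? x) + ∑[ i < t ] indicator (fullResidue? (K * d + i))
      ≡⟨ cong₂ _+_ (blocks K ≤-refl) (trans (∑-cong t top) (∑-const t 1)) ⟩
    K * t + t * 1
      ≡⟨ cong (K * t +_) (*-identityʳ t) ⟩
    K * t + t
      ≡⟨ +-comm (K * t) t ⟩
    suc K * t ∎
    where
    open ≡-Reasoning
    top : ∀ i → i < t → indicator (fullResidue? (K * d + i)) ≡ 1
    top i _ = indicator-yes (fullResidue? (K * d + i)) (inj₁ (m≤m+n (K * d) i))

module Quotient (G : Graph) {m d : ℕ} .{{_ : NonZero d}} (y : Fin (N G) → ℕ) (y<m*d : ∀ v → y v < m * d) where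

  colouring : Fin (N G) → Fin m
  colouring v = fromℕ< (m<n*o⇒m/o<n (y<m*d v))

  toℕ-colouring : ∀ v → toℕ (colouring v) ≡ y v / d
  toℕ-colouring v = toℕ-fromℕ< (m<n*o⇒m/o<n (y<m*d v))

  colouring-proper : (∀ {u v} → Adj G u v → d ≤ ∣ y u - y v ∣) → IsColoring G m colouring
  colouring-proper far {u} {v} uv fu≡fv =
    distance⇒/-≢ (far uv) (trans (sym (toℕ-colouring u)) (trans (cong toℕ fu≡fv) (toℕ-colouring v)))

ndColorable⇒colorable : ∀ G {n d m} .{{_ : NonZero d}} → n ≤ m * d → NDColorable G n d → Colorable G m
ndColorable⇒colorable G {n} {d} {m} n≤m*d (c , nd) =
  colouring , colouring-proper (proj₁ ∘ nd)
  where
  open Quotient G {m} (toℕ ∘ c) (λ v → <-≤-trans (toℕ<n (c v)) n≤m*d)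

module Labellings (G : Graph) (n d : ℕ) where

  private
    V : Set
    V = Fin (N G)

  -- Labels whose residues mod n form an (n,d)-colouring.
  IsLabelling : (V → ℕ) → Set
  IsLabelling L = ∀ {u v} → Adj G u v → Separated n d (L u) (L v) ⊎ Separated n d (L v) (L u)

  TightEdge : (V → ℕ) → V → V → Set
  TightEdge L u v = Adj G u v × Tight n d (L u) (L v)

  tightEdge? : ∀ L u v → Dec (TightEdge L u v)
  tightEdge? L u v = dec G u v ×-dec ((L u + d ≟ L v) ⊎-dec (L u + d ≟ L v + n))

  Saturated : (V → ℕ) → Set
  Saturated L = ∀ v → Σ V λ u → TightEdge L u v

  labelling-distance : ∀ {L} → IsLabelling L → ∀ {u v} → Adj G u v → d ≤ ∣ L u - L v ∣
  labelling-distance lab uv = proj₁ (separated-either⇒distance (lab uv))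

  labelling-adjacent-≤ : ∀ {L} → IsLabelling L → ∀ {u v} → Adj G u v → L u ≤ L v + n
  labelling-adjacent-≤ lab {u} {v} uv with lab uv
  ... | inj₁ (Lu+d≤Lv , _) = ≤-trans (m≤m+n _ d) (≤-trans Lu+d≤Lv (m≤m+n _ n))
  ... | inj₂ (_ , Lu+d≤Lv+n) = ≤-trans (m≤m+n _ d) Lu+d≤Lv+n

  ndColoring⇒labelling : ∀ {c} → d ≤ n → IsNDColoring G n d c → IsLabelling (toℕ ∘ c)
  ndColoring⇒labelling d≤n nd uv = distance⇒separated d≤n (proj₁ (nd uv)) (proj₂ (nd uv))

  labelling⇒ndColoring : ∀ {L} (L<n : ∀ v → L v < n) → IsLabelling L →
                         IsNDColoring G n d (λ v → fromℕ< (L<n v))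
  labelling⇒ndColoring L<n lab {u} {v} uv
    rewrite toℕ-fromℕ< (L<n u) | toℕ-fromℕ< (L<n v) = separated-either⇒distance (lab uv)

  labelling-+ : ∀ {L} s → IsLabelling L → IsLabelling (λ v → L v + s)
  labelling-+ s lab uv = Sum.map (separated-+ s) (separated-+ s) (lab uv)

  saturated-+ : ∀ {L} s → Saturated L → Saturated (λ v → L v + s)
  saturated-+ {L} s sat v with sat v
  ... | u , uv , t = u , uv , tight-+ {a = L u} s t

  module _ .{{_ : NonZero n}} where

    labelling-% : ∀ {L} → IsLabelling L → IsLabelling (λ v → L v % n)
    labelling-% lab uv = [ separated-% , Sum.swap ∘ separated-% ]′ (lab uv)

    saturated-% : ∀ {L} → d < n → Saturated L → Saturated (λ v → L v % n)
    saturated-% d<n sat v with sat v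
    ... | u , uv , t = u , uv , tight-% d<n t

∃-threshold : ∀ {p} {P : ℕ → Set p} → Decidable P → P 0 → ∀ m → ¬ P m →
              ∃ λ j → j < m × P j × ¬ P (suc j)
∃-threshold P? p0 zero    ¬pm = contradiction p0 ¬pm
∃-threshold P? p0 (suc m) ¬pm with P? m
... | yes pm = m , ≤-refl , pm , ¬pm
... | no ¬pm′ with ∃-threshold P? p0 m ¬pm′
...   | j , j<m , pj , ¬pj+1 = j , m<n⇒m<1+n j<m , pj , ¬pj+1

module TightWalks (G : Graph) (n d : ℕ) where

  open Labellings G n d

  private
    V : Set
    V = Fin (N G)

  -- A walk of i tight edges ending at v, read backwards from v.
  data TightWalk (L : V → ℕ) : V → ℕ → Set where
    []  : ∀ {v} → TightWalk L v 0
    _∷_ : ∀ {u v i} → TightEdge L u v → TightWalk L u i → TightWalk L v (suc i)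

  tightWalk? : ∀ L v i → Dec (TightWalk L v i)
  tightWalk? L v zero = yes []
  tightWalk? L v (suc i) with any? (λ u → tightEdge? L u v ×-dec tightWalk? L u i)
  ... | yes (u , e , w) = yes (e ∷ w)
  ... | no ¬ext = no λ { (e ∷ w) → ¬ext (_ , e , w) }

  tightWalk-≤ : ∀ {L v i j} → TightWalk L v i → j ≤ i → TightWalk L v j
  tightWalk-≤ w       z≤n       = []
  tightWalk-≤ (e ∷ w) (s≤s j≤i) = e ∷ tightWalk-≤ w j≤i

  vertexAt : ∀ {L v i} → TightWalk L v i → ℕ → V
  vertexAt {v = v} w       zero    = v
  vertexAt {v = v} []      (suc l) = v
  vertexAt         (e ∷ w) (suc l) = vertexAt w l

  vertexAt-tight : ∀ {L v i} (w : TightWalk L v i) l → l < i → TightEdge L (vertexAt w (suc l)) (vertexAt w l)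
  vertexAt-tight (e ∷ w) zero    _         = e
  vertexAt-tight (e ∷ w) (suc l) (s≤s l<i) = vertexAt-tight w l l<i

  TightClosed : (V → ℕ) → (V → Set) → Set
  TightClosed L C = ∀ v → C v → ∃ λ u → C u × TightEdge L u v

  -- A walk with more edges than there are vertices revisits a vertex, closing up a tight cycle.
  longWalk⇒tightClosed : ∀ {L v} → TightWalk L v (N G) → Σ (V → Set) λ C → ∃ C × TightClosed L C
  longWalk⇒tightClosed {L} w with pigeonhole (n<1+n (N G)) (vertexAt w ∘ toℕ)
  ... | i , j , i<j , wi≡wj = OnCycle , (vertexAt w a , a , ≤-refl , a≤b , refl) , closed
    where
    a b : ℕ
    a = toℕ i
    b = toℕ j
    a≤b : a ≤ b
    a≤b = <⇒≤ i<j
    b≤N : b ≤ N G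
    b≤N = ≤-pred (toℕ<n j)
    OnCycle : V → Set
    OnCycle x = ∃ λ l → a ≤ l × l ≤ b × vertexAt w l ≡ x
    closed : TightClosed L OnCycle
    closed _ (l , a≤l , l≤b , refl) with m≤n⇒m<n∨m≡n l≤b
    ... | inj₁ l<b = vertexAt w (suc l) , (suc l , m≤n⇒m≤1+n a≤l , l<b , refl) ,
                     vertexAt-tight w l (<-≤-trans l<b b≤N)
    ... | inj₂ refl = vertexAt w (suc a) , (suc a , n≤1+n a , i<j , refl) ,
                      subst (TightEdge L (vertexAt w (suc a))) wi≡wj (vertexAt-tight w a (<-≤-trans i<j b≤N))

  module Heights (L : V → ℕ) (short : ∀ v → ¬ TightWalk L v (N G)) where

    private
      threshold : ∀ v → ∃ λ j → j < N G × TightWalk L v j × ¬ TightWalk L v (suc j)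
      threshold v = ∃-threshold (tightWalk? L v) [] (N G) (short v)

    height : V → ℕ
    height v = proj₁ (threshold v)

    height<N : ∀ v → height v < N G
    height<N v = proj₁ (proj₂ (threshold v))

    height-tight : ∀ {u v} → TightEdge L u v → height u < height v
    height-tight {u} {v} e with suc (height u) ≤? height v
    ... | yes lt = lt
    ... | no ¬lt = contradiction (tightWalk-≤ (e ∷ proj₁ (proj₂ (proj₂ (threshold u)))) (s≤s (≮⇒≥ ¬lt)))
                                 (proj₂ (proj₂ (proj₂ (threshold v))))

*-+1-coprime : ∀ {M n} d → n ∣ M → Coprime (M * n) (M * d + 1)
*-+1-coprime {M} {n} d n∣M {i} (i∣Mn , i∣Md+1) = ∣1⇒≡1 (∣m+n∣m⇒∣n i∣Md+1 (∣m⇒∣m*n d (∣-trans i∣n n∣M)))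
  where
  i⊥M : Coprime i M
  i⊥M {j} (j∣i , j∣M) = ∣1⇒≡1 (∣m+n∣m⇒∣n (∣-trans j∣i i∣Md+1) (∣m⇒∣m*n d j∣M))
  i∣n : i ∣ n
  i∣n = coprime-divisor i⊥M i∣Mn

2*[M*d+1]≤M*n : ∀ {M n d} → 2 ≤ M → 2 * d < n → 2 * (M * d + 1) ≤ M * n
2*[M*d+1]≤M*n {M} {n} {d} 2≤M 2d<n = begin
  2 * (M * d + 1)          ≡⟨ expand M d ⟩
  M * (2 * d) + 2          ≤⟨ +-monoʳ-≤ (M * (2 * d)) 2≤M ⟩
  M * (2 * d) + M          ≡⟨ +-comm (M * (2 * d)) M ⟩
  M + M * (2 * d)          ≡⟨ *-suc M (2 * d) ⟨
  M * suc (2 * d)          ≤⟨ *-monoʳ-≤ M 2d<n ⟩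
  M * n                    ∎
  where
  open ≤-Reasoning
  expand : ∀ M d → 2 * (M * d + 1) ≡ M * (2 * d) + 2
  expand = solve-∀

M*n*d<n*[M*d+1] : ∀ {n} M d → 0 < n → M * n * d < n * (M * d + 1)
M*n*d<n*[M*d+1] {n} M d 0<n = begin-strict
  M * n * d          <⟨ m<m+n (M * n * d) 0<n ⟩
  M * n * d + n      ≡⟨ expand M n d ⟩
  n * (M * d + 1)    ∎
  where
  open ≤-Reasoning
  expand : ∀ M n d → M * n * d + n ≡ n * (M * d + 1)
  expand = solve-∀

module _ (G : Graph) {n d : ℕ} .{{_ : NonZero n}} where

  open Labellings
  open TightWalks G n d

  shortTightWalks⇒smallerRatio : 2 * d < n → ∀ {c} → IsNDColoring G n d c →
    (∀ v → ¬ TightWalk (toℕ ∘ c) v (N G)) →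
    ∃₂ λ n′ d′ → ValidND n′ d′ × NDColorable G n′ d′ × n′ * d < n * d′
  shortTightWalks⇒smallerRatio 2d<n {c} nd short =
    M * n , M * d + 1 , valid ,
    ((λ v → fromℕ< (c′<Mn v)) , labelling⇒ndColoring G (M * n) (M * d + 1) c′<Mn labelling′) , ratio
    where
    open Heights (toℕ ∘ c) short
    M : ℕ
    M = n * suc (suc (N G))
    2≤M : 2 ≤ M
    2≤M = ≤-trans (s≤s (s≤s z≤n)) (m≤n*m (suc (suc (N G))) n)
    height<M : ∀ v → height v < M
    height<M v = <-≤-trans (height<N v) (≤-trans (≤-trans (n≤1+n (N G)) (n≤1+n _)) (m≤n*m _ n))
    c′ : Fin (N G) → ℕ
    c′ v = M * toℕ (c v) + height v
    c′<Mn : ∀ v → c′ v < M * n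
    c′<Mn v = begin-strict
      M * toℕ (c v) + height v   <⟨ +-monoʳ-< (M * toℕ (c v)) (height<M v) ⟩
      M * toℕ (c v) + M          ≡⟨ +-comm (M * toℕ (c v)) M ⟩
      M + M * toℕ (c v)          ≡⟨ *-suc M (toℕ (c v)) ⟨
      M * suc (toℕ (c v))        ≤⟨ *-monoʳ-≤ M (toℕ<n (c v)) ⟩
      M * n                      ∎
      where open ≤-Reasoning
    d≤n : d ≤ n
    d≤n = ≤-trans (m≤m+n d (d + 0)) (<⇒≤ 2d<n)
    scaled : ∀ {u v} → Adj G u v → Separated n d (toℕ (c u)) (toℕ (c v)) →
             Separated (M * n) (M * d + 1) (c′ u) (c′ v)
    scaled uv s = *-+-separated (height<M _) (height<M _) s
      (λ eq → height-tight (uv , Sum.inj₁ eq)) (λ eq → height-tight (Graph.sym G uv , Sum.inj₂ eq))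
    labelling′ : IsLabelling G (M * n) (M * d + 1) c′
    labelling′ uv = Sum.map (scaled uv) (scaled (Graph.sym G uv)) (ndColoring⇒labelling G n d d≤n nd uv)
    valid : ValidND (M * n) (M * d + 1)
    valid = m≤n+m 1 (M * d) , 2*[M*d+1]≤M*n 2≤M 2d<n ,
            coprime⇒gcd≡1 (*-+1-coprime {M} {n} d (m∣m*n (suc (suc (N G)))))
    ratio : M * n * d < n * (M * d + 1)
    ratio = M*n*d<n*[M*d+1] M d (>-nonZero⁻¹ n)

∈⇒≤sum : ∀ {m ms} → m ∈ ms → m ≤ sum ms
∈⇒≤sum {ms = m ∷ ms} (here refl) = m≤m+n m (sum ms)
∈⇒≤sum {ms = m ∷ ms} (there m∈ms) = ≤-trans (∈⇒≤sum m∈ms) (m≤n+m (sum ms) m)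

sum-map-≤ : ∀ {A : Set} {f g : A → ℕ} (xs : List A) → (∀ y → f y ≤ g y) → sum (map f xs) ≤ sum (map g xs)
sum-map-≤ []       f≤g = z≤n
sum-map-≤ (y ∷ ys) f≤g = +-mono-≤ (f≤g y) (sum-map-≤ ys f≤g)

sum-map-< : ∀ {A : Set} {f g : A → ℕ} (xs : List A) {x} → (∀ y → f y ≤ g y) → x ∈ xs → f x < g x →
            sum (map f xs) < sum (map g xs)
sum-map-< (y ∷ ys) f≤g (here refl) fx<gx = +-mono-<-≤ fx<gx (sum-map-≤ ys f≤g)
sum-map-< (y ∷ ys) f≤g (there x∈ys) fx<gx = +-mono-≤-< (f≤g y) (sum-map-< ys f≤g x∈ys fx<gx)

module Saturation (G : Graph) (n d : ℕ) where

  open Labellings G n d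
  open TightWalks G n d

  private
    V : Set
    V = Fin (N G)

  lowerAt : (V → ℕ) → V → V → ℕ
  lowerAt L v x with x Fin.≟ v
  ... | yes _ = pred (L v)
  ... | no  _ = L x

  lowerAt-self : ∀ L v → lowerAt L v v ≡ pred (L v)
  lowerAt-self L v with v Fin.≟ v
  ... | yes _ = refl
  ... | no v≢v = contradiction refl v≢v

  lowerAt-other : ∀ L {v x} → x ≢ v → lowerAt L v x ≡ L x
  lowerAt-other L {v} {x} x≢v with x Fin.≟ v
  ... | yes x≡v = contradiction x≡v x≢v
  ... | no  _   = refl

  lowerAt-≤ : ∀ L v x → lowerAt L v x ≤ L x
  lowerAt-≤ L v x with x Fin.≟ v
  ... | yes refl = pred[n]≤n
  ... | no  _    = ≤-refl

  -- Lowering a label without a tight in-neighbour can only break a tight out-edge, never a separation.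
  lowerAt-labelling : ∀ {L v} → IsLabelling L → 0 < L v → ¬ (∃ λ u → TightEdge L u v) →
                      IsLabelling (lowerAt L v)
  lowerAt-labelling {L} {v} lab 0<Lv ¬tight {x} {y} xy with x Fin.≟ v | y Fin.≟ v
  ... | yes refl | yes refl = contradiction xy (irrefl G)
  ... | yes refl | no  _    = pred-separated 0<Lv (λ t → ¬tight (y , Graph.sym G xy , t)) (lab xy)
  ... | no  _    | yes refl = Sum.swap (pred-separated 0<Lv (λ t → ¬tight (x , xy , t)) (Sum.swap (lab xy)))
  ... | no  _    | no  _    = lab xy

  path-≤ : ∀ {L} → IsLabelling L → ∀ {u v} p q → Linked (Adj G) (u ∷ p) → u ∷ p ≡ q ++ v ∷ [] →
           L u ≤ L v + n * length p
  path-≤ {L} lab {u} [] [] _ refl = m≤m+n (L u) (n * 0)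
  path-≤ lab [] (x ∷ []) _ ()
  path-≤ lab [] (x ∷ y ∷ q) _ ()
  path-≤ lab (y ∷ p) [] _ ()
  path-≤ {L} lab {u} {v} (y ∷ p) (x ∷ q) (uy ∷ linked) eq = begin
    L u                           ≤⟨ labelling-adjacent-≤ lab uy ⟩
    L y + n                       ≤⟨ +-monoˡ-≤ n (path-≤ lab p q linked (proj₂ (∷-injective eq))) ⟩
    L v + n * length p + n        ≡⟨ +-assoc (L v) (n * length p) n ⟩
    L v + (n * length p + n)      ≡⟨ cong (L v +_) (+-comm (n * length p) n) ⟩
    L v + (n + n * length p)      ≡⟨ cong (L v +_) (*-suc n (length p)) ⟨
    L v + n * length (y ∷ p)      ∎
    where open ≤-Reasoning

  module _ (connected : Connected G) where

    connected-≤ : ∀ {L} → IsLabelling L → ∀ u v → L u ≤ L v + n * length (proj₁ (connected u v))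
    connected-≤ lab u v with connected u v
    ... | p , (linked , _) , q , eq = path-≤ lab p q linked eq

  module _ (connected : Connected G) {L₀ : V → ℕ} (lab₀ : IsLabelling L₀)
           (C : V → Set) {z : V} (Cz : C z) (closed : TightClosed L₀ C) where

    private
      pathLength : V → ℕ
      pathLength v = length (proj₁ (connected z v))

      pathLengths : ℕ
      pathLengths = sum (map pathLength (allFin (N G)))

      offset : ℕ
      offset = suc (n * pathLengths)

      L₁ : V → ℕ
      L₁ v = L₀ v + offset

      -- Keeping C at its initial labels keeps a tight cycle in place; it anchors every label above 0.
      Invariant : (V → ℕ) → Set
      Invariant L = IsLabelling L × (∀ v → C v → L v ≡ L₁ v)

      total : (V → ℕ) → ℕ
      total L = sum (map L (allFin (N G)))

      positive : ∀ {L} → Invariant L → ∀ v → 0 < L v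
      positive {L} (lab , fixed) v = +-cancelʳ-≤ (n * pathLengths) 1 (L v) (begin
        1 + n * pathLengths          ≤⟨ m≤n+m offset (L₀ z) ⟩
        L₁ z                         ≡⟨ fixed z Cz ⟨
        L z                          ≤⟨ connected-≤ connected lab z v ⟩
        L v + n * pathLength v       ≤⟨ +-monoʳ-≤ (L v) (*-monoʳ-≤ n pathLength≤) ⟩
        L v + n * pathLengths        ∎)
        where
        open ≤-Reasoning
        pathLength≤ : pathLength v ≤ pathLengths
        pathLength≤ = ∈⇒≤sum (∈-map⁺ pathLength (∈-allFin v))

      lower-invariant : ∀ {L v} → Invariant L → ¬ (∃ λ u → TightEdge L u v) → Invariant (lowerAt L v)
      lower-invariant {L} {v} inv@(lab , fixed) ¬tight =
        lowerAt-labelling lab (positive inv v) ¬tight ,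
        λ x Cx → trans (lowerAt-other L (x≢v x Cx)) (fixed x Cx)
        where
        x≢v : ∀ x → C x → x ≢ v
        x≢v x Cx refl with closed x Cx
        ... | u , Cu , ux , t = ¬tight (u , ux , subst₂ (Tight n d) (sym (fixed u Cu)) (sym (fixed x Cx))
                                                       (tight-+ {a = L₀ u} offset t))

      saturate : ∀ fuel L → Invariant L → total L < fuel → ∃ λ L → IsLabelling L × Saturated L
      saturate (suc fuel) L inv bound with all? (λ v → any? (λ u → tightEdge? L u v))
      ... | yes sat = L , proj₁ inv , sat
      ... | no ¬sat with ¬∀⟶∃¬ (N G) _ (λ v → any? (λ u → tightEdge? L u v)) ¬sat
      ...   | v , ¬tight =
        saturate fuel (lowerAt L v) (lower-invariant inv ¬tight) (<-≤-trans decrease (≤-pred bound))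
        where
        lowered : lowerAt L v v < L v
        lowered = subst (_< L v) (sym (lowerAt-self L v))
                        (≤-reflexive (suc-pred (L v) {{>-nonZero (positive inv v)}}))
        decrease : total (lowerAt L v) < total L
        decrease = sum-map-< (allFin (N G)) (lowerAt-≤ L v) (∈-allFin v) lowered

    saturatedLabelling : ∃ λ L → IsLabelling L × Saturated L
    saturatedLabelling = saturate (suc (total L₁)) L₁ (labelling-+ offset lab₀ , λ _ _ → refl) ≤-refl

iterate-++ : ∀ {A : Set} (f : A → A) x a b →
             List.iterate f x (a + b) ≡ List.iterate f x a ++ List.iterate f (ℕ.iterate f x a) b
iterate-++ f x zero    b = refl
iterate-++ f x (suc a) b = cong (x ∷_) (iterate-++ f (f x) a b)

module RainbowPaths (G : Graph) {n d K t : ℕ} .{{_ : NonZero d}} (n≡Kd+t : n ≡ K * d + t) (t<d : t < d)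
                    {y : Fin (N G) → ℕ} (y<n : ∀ v → y v < n)
                    (lab : Labellings.IsLabelling G n d y) (sat : Labellings.Saturated G n d y) where

  open Labellings G n d

  private
    V : Set
    V = Fin (N G)

  y<[1+K]d : ∀ v → y v < suc K * d
  y<[1+K]d v = begin-strict
    y v         <⟨ y<n v ⟩
    n           ≡⟨ n≡Kd+t ⟩
    K * d + t   <⟨ +-monoʳ-< (K * d) t<d ⟩
    K * d + d   ≡⟨ +-comm (K * d) d ⟩
    suc K * d   ∎
    where open ≤-Reasoning

  open Quotient G {suc K} y y<[1+K]d public using (colouring)
  open Quotient G {suc K} y y<[1+K]d using (toℕ-colouring; colouring-proper)

  colouring-isColoring : IsColoring G (suc K) colouring
  colouring-isColoring = colouring-proper (labelling-distance lab)

  private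
    p : V → V
    p v = proj₁ (sat v)

    p-tight : ∀ v → Tight n d (y (p v)) (y v)
    p-tight v = proj₂ (proj₂ (sat v))

    colour : V → ℕ
    colour v = y v / d

  descend : ∀ {v j r} → y v ≡ suc j * d + r → y (p v) ≡ j * d + r
  descend {v} {j} {r} yv≡ with p-tight v
  ... | inj₁ ypv+d≡yv = +-cancelʳ-≡ d _ _ (trans ypv+d≡yv (trans yv≡ (shift j d r)))
    where
    shift : ∀ j d r → suc j * d + r ≡ j * d + r + d
    shift = solve-∀
  ... | inj₂ ypv+d≡yv+n = contradiction (begin-strict
      y (p v) + d     <⟨ +-monoˡ-< d (y<n (p v)) ⟩
      n + d           ≤⟨ +-monoʳ-≤ n (≤-trans (m≤m+n d (j * d + r)) (≤-reflexive (trans (sym (+-assoc d _ r)) (sym yv≡)))) ⟩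
      n + y v         ≡⟨ +-comm n (y v) ⟩
      y v + n         ∎) (<-irrefl ypv+d≡yv+n)
    where open ≤-Reasoning

  wrap : ∀ {v} → y v < d → y (p v) + d ≡ y v + n
  wrap {v} yv<d with p-tight v
  ... | inj₁ ypv+d≡yv = contradiction (≤-trans (m≤n+m d (y (p v))) (≤-reflexive ypv+d≡yv)) (<⇒≱ yv<d)
  ... | inj₂ ypv+d≡yv+n = ypv+d≡yv+n

  colours : ∀ {v j r} m → y v ≡ j * d + r → r < d → m ≤ suc j →
            map colour (List.iterate p v m) ≡ countdown j m
  colours zero    _   _   _ = refl
  colours {v} {j} {r} (suc m) yv≡ r<d m<1+j =
    cong₂ _∷_ (trans (cong (_/ d) yv≡) ([m*n+o]/n≡m j r<d)) (rest j m<1+j yv≡)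
    where
    rest : ∀ j → suc m ≤ suc j → y v ≡ j * d + r → map colour (List.iterate p (p v) m) ≡ countdown (pred j) m
    rest j       (s≤s z≤n)   _   = refl
    rest (suc j) (s≤s m≤1+j) yv≡ = colours m (descend {j = j} yv≡) r<d m≤1+j

  landing : ∀ {v} j {r} → y v ≡ j * d + r → r < d → y (ℕ.iterate p v (suc j)) + d ≡ r + n
  landing zero    yv≡r r<d = trans (wrap (subst (_< d) (sym yv≡r) r<d)) (cong (_+ n) yv≡r)
  landing (suc j) yv≡  r<d = landing j (descend {j = j} yv≡) r<d

  iterate-linked : ∀ v m → Linked (Adj G) (List.iterate p v m)
  iterate-linked v zero          = []
  iterate-linked v (suc zero)    = [-]
  iterate-linked v (suc (suc m)) = Graph.sym G (proj₁ (proj₂ (sat v))) ∷ iterate-linked (p v) (suc m)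

  rainbow : ∀ v m → Unique (map colour (List.iterate p v (suc m))) →
            RainbowPathFrom G (suc K) colouring v (suc m)
  rainbow v m unique =
    walk ,
    ((iterate-linked v (suc m) , Unique.map⁻ colouring-unique) , (List.iterate p (p v) m , refl) ,
     length-iterate p v (suc m)) ,
    colouring-unique
    where
    walk : List V
    walk = List.iterate p v (suc m)
    colours≡ : map colour walk ≡ map toℕ (map colouring walk)
    colours≡ = trans (map-cong (sym ∘ toℕ-colouring) walk) (map-∘ walk)
    colouring-unique : Unique (map colouring walk)
    colouring-unique = Unique.map⁻ {f = toℕ} (subst Unique colours≡ unique)

  rainbow-wrapping : ∀ {v j r} K′ {r′} → y v ≡ j * d + r → r < d → j ≤ K′ →
                     y (ℕ.iterate p v (suc j)) ≡ K′ * d + r′ → r′ < d →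
                     RainbowPathFrom G (suc K) colouring v (suc K′)
  rainbow-wrapping {v} {j} K′ yv≡ r<d j≤K′ yw≡ r′<d =
    subst (RainbowPathFrom G (suc K) colouring v) (cong suc (m+[n∸m]≡n j≤K′))
      (rainbow v (j + (K′ ∸ j)) (subst Unique (sym colours-++) (countdown-++-unique K′ j≤K′)))
    where
    w : V
    w = ℕ.iterate p v (suc j)
    colours-++ : map colour (List.iterate p v (suc j + (K′ ∸ j))) ≡
                 countdown j (suc j) ++ countdown K′ (K′ ∸ j)
    colours-++ = begin
      map colour (List.iterate p v (suc j + (K′ ∸ j)))
        ≡⟨ cong (map colour) (iterate-++ p v (suc j) (K′ ∸ j)) ⟩
      map colour (List.iterate p v (suc j) ++ List.iterate p w (K′ ∸ j))
        ≡⟨ map-++ colour (List.iterate p v (suc j)) _ ⟩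
      map colour (List.iterate p v (suc j)) ++ map colour (List.iterate p w (K′ ∸ j))
        ≡⟨ cong₂ _++_ (colours (suc j) yv≡ r<d ≤-refl)
                      (colours (K′ ∸ j) yw≡ r′<d (m≤n⇒m≤1+n (m∸n≤m K′ j))) ⟩
      countdown j (suc j) ++ countdown K′ (K′ ∸ j) ∎
      where open ≡-Reasoning

  open Residues K t t<d

  private
    yv≡j*d+r : ∀ v → y v ≡ y v / d * d + y v % d
    yv≡j*d+r v = m≡m/n*n+m%n (y v) d

    landing′ : ∀ v → y (ℕ.iterate p v (suc (y v / d))) + d ≡ y v % d + (K * d + t)
    landing′ v = trans (landing (y v / d) (yv≡j*d+r v) (m%n<n (y v) d)) (cong (y v % d +_) n≡Kd+t)

  fullPath : ∀ v → FullResidue (y v) → FullRainbowFrom G (suc K) colouring v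
  fullPath v (inj₁ Kd≤yv) =
    rainbow v K (subst Unique (sym (colours (suc K) yv≡ r<d ≤-refl)) (countdown-unique K (suc K) ≤-refl))
    where
    r : ℕ
    r = y v ∸ K * d
    yv≡ : y v ≡ K * d + r
    yv≡ = sym (m+[n∸m]≡n Kd≤yv)
    r<d : r < d
    r<d = <-trans (+-cancelˡ-< (K * d) r t (subst₂ _<_ yv≡ n≡Kd+t (y<n v))) t<d
  fullPath v (inj₂ d-t≤r) with K * d ≤? y v
  ... | yes Kd≤yv = fullPath v (inj₁ Kd≤yv)
  ... | no ¬Kd≤yv =
    rainbow-wrapping K (yv≡j*d+r v) r<d (<⇒≤ (m<n*o⇒m/o<n (≰⇒> ¬Kd≤yv))) (+-cancelʳ-≡ d _ _ yw+d≡) r′<d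
    where
    r r′ : ℕ
    r = y v % d
    r′ = r + t ∸ d
    r<d : r < d
    r<d = m%n<n (y v) d
    d≤r+t : d ≤ r + t
    d≤r+t = subst (_≤ r + t) (m∸n+n≡m (<⇒≤ t<d)) (+-monoˡ-≤ t d-t≤r)
    r′<d : r′ < d
    r′<d = +-cancelʳ-< d r′ d (subst (_< d + d) (sym (m∸n+n≡m d≤r+t)) (+-mono-< r<d t<d))
    yw+d≡ : y (ℕ.iterate p v (suc (y v / d))) + d ≡ K * d + r′ + d
    yw+d≡ = begin
      y (ℕ.iterate p v (suc (y v / d))) + d   ≡⟨ landing′ v ⟩
      r + (K * d + t)                          ≡⟨ x∙yz≈y∙xz r (K * d) t ⟩
      K * d + (r + t)                          ≡⟨ cong (K * d +_) (m∸n+n≡m d≤r+t) ⟨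
      K * d + (r′ + d)                         ≡⟨ +-assoc (K * d) r′ d ⟨
      K * d + r′ + d                           ∎
      where open ≡-Reasoning

  shortPath : ∀ v → ¬ FullResidue (y v) → RainbowPathFrom G (suc K) colouring v K
  shortPath v ¬full =
    subst (RainbowPathFrom G (suc K) colouring v) 1+K′≡K
      (rainbow-wrapping K′ (yv≡j*d+r v) r<d j≤K′ (+-cancelʳ-≡ d _ _ yw+d≡) r+t<d)
    where
    r K′ : ℕ
    r = y v % d
    K′ = pred K
    r<d : r < d
    r<d = m%n<n (y v) d
    j<K : y v / d < K
    j<K = m<n*o⇒m/o<n (≰⇒> (¬full ∘ inj₁))
    1+K′≡K : suc K′ ≡ K
    1+K′≡K = suc-pred K {{>-nonZero (<-≤-trans z<s j<K)}}
    j≤K′ : y v / d ≤ K′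
    j≤K′ = <⇒≤pred j<K
    r+t<d : r + t < d
    r+t<d = subst (r + t <_) (m∸n+n≡m (<⇒≤ t<d)) (+-monoˡ-< t (≰⇒> (¬full ∘ inj₂)))
    yw+d≡ : y (ℕ.iterate p v (suc (y v / d))) + d ≡ K′ * d + (r + t) + d
    yw+d≡ = begin
      y (ℕ.iterate p v (suc (y v / d))) + d   ≡⟨ landing′ v ⟩
      r + (K * d + t)                          ≡⟨ cong (λ k → r + (k * d + t)) 1+K′≡K ⟨
      r + (suc K′ * d + t)                     ≡⟨ rearrange r K′ d t ⟩
      K′ * d + (r + t) + d                     ∎
      where
      open ≡-Reasoning
      rearrange : ∀ r k d t → r + (suc k * d + t) ≡ k * d + (r + t) + d
      rearrange = solve-∀

counting-bound : ∀ {n d K t N ℓ} → n ≡ K * d + t → N * (suc K * t) ≤ n * ℓ →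
                 suc K * (n + d) * N ≤ ℓ * n + suc K * suc K * d * N
counting-bound {n} {d} {K} {t} {N} {ℓ} n≡Kd+t count = begin
  suc K * (n + d) * N                         ≡⟨ cong (λ m → suc K * (m + d) * N) n≡Kd+t ⟩
  suc K * (K * d + t + d) * N                 ≡⟨ expand K d t N ⟩
  N * (suc K * t) + suc K * suc K * d * N     ≤⟨ +-monoˡ-≤ (suc K * suc K * d * N) count ⟩
  n * ℓ + suc K * suc K * d * N               ≡⟨ cong (_+ suc K * suc K * d * N) (*-comm n ℓ) ⟩
  ℓ * n + suc K * suc K * d * N               ∎
  where
  open ≤-Reasoning
  expand : ∀ K d t N → suc K * (K * d + t + d) * N ≡ N * (suc K * t) + suc K * suc K * d * N
  expand = solve-∀

module _ (G : Graph) where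

  open Labellings G
  open TightWalks G

  ndColorable⇒[χ-1]d<n : ∀ {n d K} .{{_ : NonZero d}} → ChromaticNumber G (suc K) → NDColorable G n d → K * d < n
  ndColorable⇒[χ-1]d<n {n} {d} {K} (_ , minimal) nd with K * d <? n
  ... | yes Kd<n = Kd<n
  ... | no ¬Kd<n = contradiction (ndColorable⇒colorable G (≮⇒≥ ¬Kd<n) nd) (minimal K (n<1+n K))

  minimal⇒longTightWalk : ∀ {n d} .{{_ : NonZero n}} → 2 * d < n → CircularChromaticNumber G n d →
                          ∃ λ c → IsNDColoring G n d c × ∃ λ v → TightWalk n d (toℕ ∘ c) v (N G)
  minimal⇒longTightWalk {n} {d} 2d<n ((c , nd) , minimal) with any? (λ v → tightWalk? n d (toℕ ∘ c) v (N G))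
  ... | yes long = c , nd , long
  ... | no ¬long with shortTightWalks⇒smallerRatio G 2d<n nd (λ v w → ¬long (v , w))
  ...   | n′ , d′ , valid , colorable , smaller = contradiction (minimal n′ d′ valid colorable) (<⇒≱ smaller)

  saturatedLabelling-exists : ∀ {n d} .{{_ : NonZero n}} → Connected G → 2 * d < n → CircularChromaticNumber G n d →
                              ∃ λ L → IsLabelling n d L × Saturated n d L
  saturatedLabelling-exists {n} {d} connected 2d<n χc with minimal⇒longTightWalk 2d<n χc
  ... | c , nd , v , long with longWalk⇒tightClosed n d long
  ...   | C , (z , Cz) , closed =
    Saturation.saturatedLabelling G n d connected (ndColoring⇒labelling n d d≤n nd) C Cz closed
    where
    d≤n : d ≤ n
    d≤n = ≤-trans (m≤m+n d (d + 0)) (<⇒≤ 2d<n)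

  saturatedLabelling⇒rainbowColouring : ∀ {n d K t} .{{_ : NonZero n}} .{{_ : NonZero d}} →
    n ≡ K * d + t → t < d → d < n → (∃ λ L → IsLabelling n d L × Saturated n d L) →
    Σ (Fin (N G) → Fin (suc K)) λ f → IsColoring G (suc K) f ×
      (Σ (List (Fin (N G))) λ S → Unique S × (∀ u → u ∈ S → FullRainbowFrom G (suc K) f u) ×
        suc K * (n + d) * N G ≤ length S * n + suc K * suc K * d * N G) ×
      (∀ v → ¬ FullRainbowFrom G (suc K) f v → RainbowPathFrom G (suc K) f v K)
  saturatedLabelling⇒rainbowColouring {n} {d} {K} {t} n≡Kd+t t<d d<n (L , lab , sat) =
    colouring , colouring-isColoring ,
    (S s , Unique.filter⁺ (full? s) (Unique.allFin⁺ (N G)) ,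
      (λ u u∈S → fullPath u (proj₂ (∈-filter⁻ (full? s) {xs = allFin (N G)} u∈S))) ,
      counting-bound {K = K} n≡Kd+t average) ,
    λ v ¬full → shortPath v (¬full ∘ fullPath v)
    where
    open Residues K t t<d
    shifted : ℕ → Fin (N G) → ℕ
    shifted s v = (L v + s) % n
    full? : ∀ s v → Dec (FullResidue (shifted s v))
    full? s v = fullResidue? (shifted s v)
    S : ℕ → List (Fin (N G))
    S s = filter (full? s) (allFin (N G))
    ∑-S : ∑[ s < n ] length (S s) ≡ N G * (suc K * t)
    ∑-S = trans (∑-length-filter full? n (suc K * t) (allFin (N G)) per-vertex)
                (cong (_* (suc K * t)) (length-tabulate {n = N G} id))
      where
      per-vertex : ∀ v → ∑[ s < n ] indicator (full? s v) ≡ suc K * t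
      per-vertex v = trans (∑-rotate n (L v) (indicator ∘ fullResidue?))
                           (trans (cong (λ m → ∑< m (indicator ∘ fullResidue?)) n≡Kd+t) ∑-fullResidue)
    best : ∃ λ s → s < n × ∑[ s′ < n ] length (S s′) ≤ n * length (S s)
    best = ∃-term-≥-average n (length ∘ S) (>-nonZero⁻¹ n)
    s : ℕ
    s = proj₁ best
    average : N G * (suc K * t) ≤ n * length (S s)
    average = subst (_≤ n * length (S s)) ∑-S (proj₂ (proj₂ best))
    open RainbowPaths G {K = K} n≡Kd+t t<d (λ v → m%n<n (L v + s) n)
           (labelling-% n d (labelling-+ n d s lab)) (saturated-% n d d<n (saturated-+ n d s sat))

theorem2 : (k n d : ℕ) → 1 ≤ k → 1 ≤ n → 1 ≤ d → 2 * d ≤ n → gcd n d ≡ 1 → n < k * d →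
    (G : Graph) → Connected G → ChromaticNumber G k → CircularChromaticNumber G n d →
    Σ (Fin (N G) → Fin k) λ f → IsColoring G k f ×
      (Σ (List (Fin (N G))) λ S → Unique S × (∀ u → u ∈ S → FullRainbowFrom G k f u) ×
        k * (n + d) * N G ≤ length S * n + k * k * d * N G) ×
      (∀ v → ¬ FullRainbowFrom G k f v → RainbowPathFrom G k f v (k ∸ 1))
theorem2 zero    _ _ () _ _ _ _ _ _ _ _ _
theorem2 (suc K) n d _ 1≤n 1≤d 2d≤n _ n<[1+K]d G connected χ χc =
  saturatedLabelling⇒rainbowColouring G n≡Kd+t t<d d<n (saturatedLabelling-exists G connected 2d<n χc)
  where
  instance
    n≢0 : NonZero n
    n≢0 = >-nonZero 1≤n
    d≢0 : NonZero d
    d≢0 = >-nonZero 1≤d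
  Kd<n : K * d < n
  Kd<n = ndColorable⇒[χ-1]d<n G χ (proj₁ χc)
  t : ℕ
  t = n ∸ K * d
  n≡Kd+t : n ≡ K * d + t
  n≡Kd+t = sym (m+[n∸m]≡n (<⇒≤ Kd<n))
  t<d : t < d
  t<d = +-cancelˡ-< (K * d) t d (subst₂ _<_ n≡Kd+t (+-comm d (K * d)) n<[1+K]d)
  2d<n : 2 * d < n
  2d<n with m≤n⇒m<n∨m≡n 2d≤n
  ... | inj₁ 2d<n = 2d<n
  ... | inj₂ refl = contradiction (*-cancelʳ-< d 2 (suc K) n<[1+K]d) (<⇒≱ (s≤s (*-cancelʳ-< d K 2 Kd<n)))
  d<n : d < n
  d<n = ≤-<-trans (m≤m+n d (d + 0)) 2d<n
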